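{- Formulas of the modal logics $\mathrm{ML}_{\dot\vee,\Diamond}({=}(\cdot),\Diamond_e)$, $\mathrm{ML}_{\to,\Diamond}(\dot\vee_g,\Diamond_e)$ and $\mathrm{ML}_{\to,\Diamond}(\Diamond_e)$ are convex.
   Context: Modal team semantics over Kripke models $M=(W,R,V)$, teams $t\subseteq W$. The logics extend, respectively, $\mathrm{CONDEP}$ (connectives $p,\bot,\wedge,\dot\vee$, negation of classical formulas, dependence atoms over classical modal formulas, $\Diamond_e$), $\mathrm{CONINQ}$ ($p,\bot,\wedge,\to,\dot\vee_g,\Diamond_e$) and $\mathrm{PL}_{\to}(\Diamond_e)$ ($p,\bot,\wedge,\to,\Diamond_e$) with flat modalities: $M,t\vDash\Diamond\phi$ iff every $w\in t$ has a nonempty $s\subseteq R[w]$ with $M,s\vDash\phi$; $M,t\vDash\Box\phi$ iff $M,R[w]\vDash\phi$ for every $w\in t$. Clauses: $t\vDash p$ iff $t\subseteq V(p)$; $t\vDash\bot$ iff $t=\emptyset$; $t\vDash\phi\,\dot\vee\,\psi$ iff $t\subseteq s\cup u$ with $s\vDash\phi,u\vDash\psi$; $t\vDash\phi\to\psi$ iff every $s\subseteq t$ satisfying $\phi$ satisfies $\psi$; $t\vDash\Diamond_e\phi$ ("epistemic might") iff some nonempty $s\subseteq t$ satisfies $\phi$; $t\vDash\phi\,\dot\vee_g\,\psi$ iff some $s\supseteq t$ satisfies $\phi$ or $\psi$. Convex: $s\vDash\phi$, $t\vDash\phi$, $s\subseteq u\subseteq t$ imply $u\vDash\phi$. -}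

module Defs where

open import Level using (Level; _⊔_) renaming (suc to lsuc; zero to lzero)
open import Data.Nat using (ℕ)
open import Data.Empty using (⊥)
open import Data.Product using (Σ; _×_; _,_)
open import Data.Sum using (_⊎_)
open import Data.List using (List)
open import Data.List.Relation.Unary.All using (All)
open import Function.Bundles using (_⇔_)
open import Relation.Nullary using (¬_)

record Model : Set₁ where
  field
    W : Set
    R : W → W → Set
    V : ℕ → W → Set

open Model public

Team : Model → Set₁
Team M = W M → Set

_⊆_ : {A : Set} → (A → Set) → (A → Set) → Set
_⊆_ {A} s t = (w : A) → s w → t w

_∪_ : {A : Set} → (A → Set) → (A → Set) → (A → Set)
(s ∪ u) w = s w ⊎ u w

Nonempty : {A : Set} → (A → Set) → Set
Nonempty {A} s = Σ A λ w → s w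

Succ : (M : Model) → W M → Team M
Succ M w v = R M w v

data CForm : Set where
  cvar : ℕ → CForm
  cbot : CForm
  cneg : CForm → CForm
  cand : CForm → CForm → CForm
  cor  : CForm → CForm → CForm
  cdia : CForm → CForm
  cbox : CForm → CForm

_,_⊩_ : (M : Model) → W M → CForm → Set
M , w ⊩ cvar p   = V M p w
M , w ⊩ cbot     = ⊥
M , w ⊩ cneg α   = ¬ (M , w ⊩ α)
M , w ⊩ cand α β = (M , w ⊩ α) × (M , w ⊩ β)
M , w ⊩ cor α β  = (M , w ⊩ α) ⊎ (M , w ⊩ β)
M , w ⊩ cdia α   = Σ (W M) λ v → R M w v × (M , v ⊩ α)
M , w ⊩ cbox α   = (v : W M) → R M w v → M , v ⊩ α

-- ML_{∨̇,◇}(=(·),◇e)   (extension of CONDEP with flat ◇, □)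

data DepForm : Set where
  var   : ℕ → DepForm
  bot   : DepForm
  neg   : CForm → DepForm
  dep   : List CForm → CForm → DepForm
  and   : DepForm → DepForm → DepForm
  bor   : DepForm → DepForm → DepForm
  dia   : DepForm → DepForm
  box   : DepForm → DepForm
  diae  : DepForm → DepForm

_,_⊨ᵈ_ : (M : Model) → Team M → DepForm → Set₁
M , t ⊨ᵈ var p    = Level.Lift (lsuc lzero) (t ⊆ V M p)
M , t ⊨ᵈ bot      = Level.Lift (lsuc lzero) ((w : W M) → ¬ t w)
M , t ⊨ᵈ neg α    = Level.Lift (lsuc lzero) ((w : W M) → t w → ¬ (M , w ⊩ α))
M , t ⊨ᵈ dep αs β = Level.Lift (lsuc lzero) ((w v : W M) → t w → t v →
                       All (λ α → (M , w ⊩ α) ⇔ (M , v ⊩ α)) αs →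
                       (M , w ⊩ β) ⇔ (M , v ⊩ β))
M , t ⊨ᵈ and φ ψ  = (M , t ⊨ᵈ φ) × (M , t ⊨ᵈ ψ)
M , t ⊨ᵈ bor φ ψ  = Σ (Team M) λ s → Σ (Team M) λ u →
                       Level.Lift (lsuc lzero) (t ⊆ (s ∪ u)) × (M , s ⊨ᵈ φ) × (M , u ⊨ᵈ ψ)
M , t ⊨ᵈ dia φ    = (w : W M) → t w → Σ (Team M) λ s →
                       Level.Lift (lsuc lzero) (Nonempty s × (s ⊆ Succ M w)) × (M , s ⊨ᵈ φ)
M , t ⊨ᵈ box φ    = (w : W M) → t w → M , Succ M w ⊨ᵈ φ
M , t ⊨ᵈ diae φ   = Σ (Team M) λ s → Level.Lift (lsuc lzero) (Nonempty s × (s ⊆ t)) × (M , s ⊨ᵈ φ)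

-- ML_{→,◇}(∨̇_g,◇e)   (extension of CONINQ with flat ◇, □)

data InqForm : Set where
  var   : ℕ → InqForm
  bot   : InqForm
  and   : InqForm → InqForm → InqForm
  imp   : InqForm → InqForm → InqForm
  gor   : InqForm → InqForm → InqForm
  dia   : InqForm → InqForm
  box   : InqForm → InqForm
  diae  : InqForm → InqForm

_,_⊨ⁱ_ : (M : Model) → Team M → InqForm → Set₁
M , t ⊨ⁱ var p    = Level.Lift (lsuc lzero) (t ⊆ V M p)
M , t ⊨ⁱ bot      = Level.Lift (lsuc lzero) ((w : W M) → ¬ t w)
M , t ⊨ⁱ and φ ψ  = (M , t ⊨ⁱ φ) × (M , t ⊨ⁱ ψ)
M , t ⊨ⁱ imp φ ψ  = (s : Team M) → s ⊆ t → M , s ⊨ⁱ φ → M , s ⊨ⁱ ψ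
M , t ⊨ⁱ gor φ ψ  = Σ (Team M) λ s → Level.Lift (lsuc lzero) (t ⊆ s) × ((M , s ⊨ⁱ φ) ⊎ (M , s ⊨ⁱ ψ))
M , t ⊨ⁱ dia φ    = (w : W M) → t w → Σ (Team M) λ s →
                       Level.Lift (lsuc lzero) (Nonempty s × (s ⊆ Succ M w)) × (M , s ⊨ⁱ φ)
M , t ⊨ⁱ box φ    = (w : W M) → t w → M , Succ M w ⊨ⁱ φ
M , t ⊨ⁱ diae φ   = Σ (Team M) λ s → Level.Lift (lsuc lzero) (Nonempty s × (s ⊆ t)) × (M , s ⊨ⁱ φ)

-- ML_{→,◇}(◇e)   (extension of PL_→(◇e) with flat ◇, □)

data ImpForm : Set where
  var   : ℕ → ImpForm
  bot   : ImpForm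
  and   : ImpForm → ImpForm → ImpForm
  imp   : ImpForm → ImpForm → ImpForm
  dia   : ImpForm → ImpForm
  box   : ImpForm → ImpForm
  diae  : ImpForm → ImpForm

_,_⊨ᵖ_ : (M : Model) → Team M → ImpForm → Set₁
M , t ⊨ᵖ var p    = Level.Lift (lsuc lzero) (t ⊆ V M p)
M , t ⊨ᵖ bot      = Level.Lift (lsuc lzero) ((w : W M) → ¬ t w)
M , t ⊨ᵖ and φ ψ  = (M , t ⊨ᵖ φ) × (M , t ⊨ᵖ ψ)
M , t ⊨ᵖ imp φ ψ  = (s : Team M) → s ⊆ t → M , s ⊨ᵖ φ → M , s ⊨ᵖ ψ
M , t ⊨ᵖ dia φ    = (w : W M) → t w → Σ (Team M) λ s →
                       Level.Lift (lsuc lzero) (Nonempty s × (s ⊆ Succ M w)) × (M , s ⊨ᵖ φ)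
M , t ⊨ᵖ box φ    = (w : W M) → t w → M , Succ M w ⊨ᵖ φ
M , t ⊨ᵖ diae φ   = Σ (Team M) λ s → Level.Lift (lsuc lzero) (Nonempty s × (s ⊆ t)) × (M , s ⊨ᵖ φ)

Convex : {F : Set} → ((M : Model) → Team M → F → Set₁) → F → Set₁
Convex sat φ = (M : Model) (s t u : Team M) →
  sat M s φ → sat M t φ → s ⊆ u → u ⊆ t → sat M u φ

-- A property of teams that is downward closed or upward closed is convex, and
-- convexity is preserved by conjunction. Every connective of the three logics
-- other than ∧ and ◇ₑ yields a downward closed formula whatever its arguments:
-- each constrains only the points, pairs of points, subteams or covers of the
-- team. The epistemic ◇ₑ yields an upward closed formula. Conjunction is the
-- only case needing the induction hypothesis, and the only reason convexity
-- rather than downward closure is the invariant: φ ∧ ◇ₑψ is neither downward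
-- nor upward closed.
module Submission where

open import Defs
open import Data.Product using (Σ; _×_; _,_)
open import Level using (Lift; lift) renaming (suc to lsuc; zero to lzero)

-- The model is an explicit argument because Team M = W M → Set does not
-- determine M; for the same reason the formula-level results below live in
-- the module that fixes M.
DownwardClosed : (M : Model) → (Team M → Set₁) → Set₁
DownwardClosed M P = {t u : Team M} → u ⊆ t → P t → P u

UpwardClosed : (M : Model) → (Team M → Set₁) → Set₁
UpwardClosed M P = {s u : Team M} → s ⊆ u → P s → P u

IsConvex : (M : Model) → (Team M → Set₁) → Set₁
IsConvex M P = {s t u : Team M} → P s → P t → s ⊆ u → u ⊆ t → P u

module _ {M : Model} where

  ⊆-trans : {s t u : Team M} → s ⊆ t → t ⊆ u → s ⊆ u
  ⊆-trans s⊆t t⊆u w sw = t⊆u w (s⊆t w sw)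

  downward⇒convex : {P : Team M → Set₁} → DownwardClosed M P → IsConvex M P
  downward⇒convex down _ Pt _ u⊆t = down u⊆t Pt

  upward⇒convex : {P : Team M → Set₁} → UpwardClosed M P → IsConvex M P
  upward⇒convex up Ps _ s⊆u _ = up s⊆u Ps

  ×-convex : {P Q : Team M → Set₁} → IsConvex M P → IsConvex M Q →
             IsConvex M (λ t → P t × Q t)
  ×-convex convP convQ (Ps , Qs) (Pt , Qt) s⊆u u⊆t =
    convP Ps Pt s⊆u u⊆t , convQ Qs Qt s⊆u u⊆t

  ⊆-downward : {P : W M → Set} → DownwardClosed M (λ t → Lift (lsuc lzero) (t ⊆ P))
  ⊆-downward u⊆t (lift t⊆P) = lift (⊆-trans u⊆t t⊆P)

  flat-downward : {P : W M → Set₁} → DownwardClosed M (λ t → (w : W M) → t w → P w)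
  flat-downward u⊆t Pt w uw = Pt w (u⊆t w uw)

  pairwise-downward : {P : W M → W M → Set} →
    DownwardClosed M (λ t → Lift (lsuc lzero) ((w v : W M) → t w → t v → P w v))
  pairwise-downward u⊆t (lift Pt) =
    lift λ w v uw uv → Pt w v (u⊆t w uw) (u⊆t v uv)

  subteams-downward : {P : Team M → Set₁} →
    DownwardClosed M (λ t → (s : Team M) → s ⊆ t → P s)
  subteams-downward u⊆t Pt s s⊆u = Pt s (⊆-trans s⊆u u⊆t)

  cover-downward : {P : Team M → Set₁} →
    DownwardClosed M (λ t → Σ (Team M) λ s → Lift (lsuc lzero) (t ⊆ s) × P s)
  cover-downward u⊆t (s , lift t⊆s , Ps) = s , lift (⊆-trans u⊆t t⊆s) , Ps

  split-cover-downward : {P Q : Team M → Set₁} →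
    DownwardClosed M (λ t → Σ (Team M) λ s → Σ (Team M) λ r →
                      Lift (lsuc lzero) (t ⊆ (s ∪ r)) × P s × Q r)
  split-cover-downward u⊆t (s , r , lift t⊆s∪r , Ps , Qr) =
    s , r , lift (⊆-trans u⊆t t⊆s∪r) , Ps , Qr

  ◇ₑ-upward : {P : Team M → Set₁} →
    UpwardClosed M (λ t → Σ (Team M) λ s → Lift (lsuc lzero) (Nonempty s × (s ⊆ t)) × P s)
  ◇ₑ-upward t⊆u (s , lift (ne , s⊆t) , Ps) = s , lift (ne , ⊆-trans s⊆t t⊆u) , Ps

  -- bot and neg α unfold to t ⊆ (λ _ → ⊥) and t ⊆ (λ w → ¬ w ⊩ α).
  convexᵈ : (φ : DepForm) → IsConvex M (M ,_⊨ᵈ φ)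
  convexᵈ (var p)    = downward⇒convex ⊆-downward
  convexᵈ bot        = downward⇒convex ⊆-downward
  convexᵈ (neg α)    = downward⇒convex ⊆-downward
  convexᵈ (dep αs β) = downward⇒convex pairwise-downward
  convexᵈ (and φ ψ)  = ×-convex (convexᵈ φ) (convexᵈ ψ)
  convexᵈ (bor φ ψ)  = downward⇒convex split-cover-downward
  convexᵈ (dia φ)    = downward⇒convex flat-downward
  convexᵈ (box φ)    = downward⇒convex flat-downward
  convexᵈ (diae φ)   = upward⇒convex ◇ₑ-upward

  convexⁱ : (φ : InqForm) → IsConvex M (M ,_⊨ⁱ φ)
  convexⁱ (var p)   = downward⇒convex ⊆-downward
  convexⁱ bot       = downward⇒convex ⊆-downward
  convexⁱ (and φ ψ) = ×-convex (convexⁱ φ) (convexⁱ ψ)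
  convexⁱ (imp φ ψ) = downward⇒convex subteams-downward
  convexⁱ (gor φ ψ) = downward⇒convex cover-downward
  convexⁱ (dia φ)   = downward⇒convex flat-downward
  convexⁱ (box φ)   = downward⇒convex flat-downward
  convexⁱ (diae φ)  = upward⇒convex ◇ₑ-upward

  convexᵖ : (φ : ImpForm) → IsConvex M (M ,_⊨ᵖ φ)
  convexᵖ (var p)   = downward⇒convex ⊆-downward
  convexᵖ bot       = downward⇒convex ⊆-downward
  convexᵖ (and φ ψ) = ×-convex (convexᵖ φ) (convexᵖ ψ)
  convexᵖ (imp φ ψ) = downward⇒convex subteams-downward
  convexᵖ (dia φ)   = downward⇒convex flat-downward
  convexᵖ (box φ)   = downward⇒convex flat-downward
  convexᵖ (diae φ)  = upward⇒convex ◇ₑ-upward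

proposition2p19 : ((φ : DepForm) → Convex _,_⊨ᵈ_ φ)
                  × ((φ : InqForm) → Convex _,_⊨ⁱ_ φ)
                  × ((φ : ImpForm) → Convex _,_⊨ᵖ_ φ)
proposition2p19 = (λ φ M _ _ _ → convexᵈ {M} φ)
                , (λ φ M _ _ _ → convexⁱ {M} φ)
                , (λ φ M _ _ _ → convexᵖ {M} φ)
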